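{- Let $\pi\in\mathsf{G}_{r,n}$ and $b=\text{B-code}(\pi)$. Then ${\mathsf{Cyc}}^0(\pi)={\mathsf{Max}}^0(b)$, ${\mathsf{Lmic}}^0(\pi)={\mathsf{Min}}^0(b)$, ${\mathsf{Lmap}}^0(\pi)={\mathsf{Rmil}}^0(b)$, ${\mathsf{Lmal}}^0(\pi)={\mathsf{Rmip}}^0(b)$, and for every $1\le t\le r-1$: ${\mathsf{Cyc}}^t(\pi)={\mathsf{Max}}^{r-t}(b)$, ${\mathsf{Lmic}}^t(\pi)={\mathsf{Min}}^{r-t}(b)$, ${\mathsf{Lmap}}^t(\pi)={\mathsf{Rmil}}^{r-t}(b)$, ${\mathsf{Lmal}}^t(\pi)={\mathsf{Rmip}}^{r-t}(b)$.
   Context: $\Sigma=\{i^{[c]}:1\le i\le n,\ c\in\mathbb{Z}/r\mathbb{Z}\}$ (base value $i$, color $c\in\{0,\dots,r-1\}$). $\mathsf{G}_{r,n}$: group under composition of bijections $\pi$ of $\Sigma$ with $\pi(i^{[c]})=\sigma_i^{[z_i+c]}$, $\sigma\in\mathfrak S_n$; window $\pi=\sigma_1^{[z_1]}\cdots\sigma_n^{[z_n]}$. B-code$(\pi)=(b_1,\dots,b_n)$, $b_i=\pi^{ -k_i}(i)=c_i^{[e_i]}$ where $k_i\ge1$ is least such that the base value of $\pi^{ -k_i}(i)$ is at most $i$. For $\pi$: ${\mathsf{Cyc}}^t(\pi)=\{\min C:C$ a cycle of $\sigma$, $\sum_{i\in C}z_i\equiv t\pmod r\}$; ${\mathsf{Lmic}}^t(\pi)$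 = base values of those $w_k=\pi^k(1)$ ($1\le k\le m$, $m\ge1$ least with $\pi^m(1)=1$) of color $t$ whose base value is smaller than that of every $w_l$, $l<k$; ${\mathsf{Lmal}}^t(\pi)=\{\sigma_i:z_i=t,\sigma_i>\sigma_j\ \forall j<i\}$; ${\mathsf{Lmap}}^t(\pi)=\{i:z_i=t,\sigma_i>\sigma_j\ \forall j<i\}$. For $b=(c_1^{[e_1]},\dots,c_n^{[e_n]})$: ${\mathsf{Max}}^t(b)=\{i:c_i=i,e_i=t\}$; ${\mathsf{Min}}^t(b)=\{i:c_i=1,e_i=t\}$; ${\mathsf{Rmil}}^t(b)=\{c_i:e_i=t,\ c_i<c_j\ \forall j>i\}$; ${\mathsf{Rmip}}^t(b)=\{i:e_i=t,\ c_i<c_j\ \forall j>i\}$. -}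

module Defs where

open import Data.Nat using (ℕ; zero; suc; _+_; _*_; _∸_; NonZero)
open import Data.Nat.DivMod using (_mod_)
open import Data.Fin using (Fin; toℕ; _<_; _≤_; _≟_; _≤?_)
open import Data.Fin.Permutation using (Permutation′; _⟨$⟩ʳ_; _⟨$⟩ˡ_)
open import Data.List using (map; upTo)
open import Data.Nat.ListAction using (sum)
open import Data.Bool using (Bool; if_then_else_)
open import Data.Product using (_×_; _,_; proj₁; proj₂; ∃-syntax)
open import Data.Product.Properties using (≡-dec)
open import Relation.Nullary.Decidable using (⌊_⌋)
open import Relation.Binary.PropositionalEquality using (_≡_)
open import Relation.Unary using (Pred)
open import Level using (0ℓ)

-- Conventions: base values 1..n are represented by Fin n (value i ↦ index i-1,
-- order preserving; base value 1 is Fin.zero).  Colours Z/rZ are Fin r.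

iter : {A : Set} → ℕ → (A → A) → A → A
iter zero f x = x
iter (suc k) f x = f (iter k f x)

-- search P fuel k = least j in [k, k+fuel) with P j, or k+fuel if none
search : (ℕ → Bool) → ℕ → ℕ → ℕ
search P zero k = k
search P (suc f) k = if P k then k else search P f (suc k)

-- the least element of Fin n (base value 1), available once Fin n is inhabited
first : {n : ℕ} → Fin n → Fin n
first Fin.zero = Fin.zero
first (Fin.suc _) = Fin.zero

-- An element π = σ_1^[z_1] ... σ_n^[z_n] of G_{r,n} (given by its window)
record G (r n : ℕ) : Set where
  constructor mkG
  field
    σ : Permutation′ n
    z : Fin n → Fin r

module _ {r n : ℕ} {{_ : NonZero r}} (g : G r n) where
  open G g

  c0 : Fin r
  c0 = 0 mod r

  _⊕_ : Fin r → Fin r → Fin r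
  a ⊕ b = (toℕ a + toℕ b) mod r

  _⊖_ : Fin r → Fin r → Fin r
  a ⊖ b = (toℕ a + (r ∸ toℕ b)) mod r

  Sig : Set
  Sig = Fin n × Fin r

  πf : Sig → Sig
  πf (i , c) = (σ ⟨$⟩ʳ i , z i ⊕ c)

  πinv : Sig → Sig
  πinv (j , c) = (σ ⟨$⟩ˡ j , c ⊖ z (σ ⟨$⟩ˡ j))

  σpow : ℕ → Fin n → Fin n
  σpow k = iter k (σ ⟨$⟩ʳ_)

  -- B-code: k_i least k ≥ 1 with base(π^{-k}(i^[0])) ≤ i  (k_i ≤ n always)
  kB : Fin n → ℕ
  kB i = search (λ k → ⌊ proj₁ (iter k πinv (i , c0)) ≤? i ⌋) n 1

  Bcode : Fin n → Sig
  Bcode i = iter (kB i) πinv (i , c0)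

  cycLen : Fin n → ℕ
  cycLen x = search (λ k → ⌊ σpow k x ≟ x ⌋) n 1

  cycSum : Fin n → Fin r
  cycSum x = sum (map (λ k → toℕ (z (σpow k x))) (upTo (cycLen x))) mod r

  Cyc : Fin r → Pred (Fin n) 0ℓ
  Cyc t x = (∀ k → x ≤ σpow k x) × cycSum x ≡ t

  Lmic : Fin r → Pred (Fin n) 0ℓ
  Lmic t x =
    ∃[ k ] (1 Data.Nat.≤ k × k Data.Nat.≤ m × iter k πf one ≡ (x , t)
             × (∀ l → 1 Data.Nat.≤ l → l Data.Nat.< k → x < proj₁ (iter l πf one)))
    where
      one : Sig
      one = (first x , c0)
      -- m ≥ 1 least with π^m(1) = 1  (m ≤ n·r always)
      m : ℕ
      m = search (λ k → ⌊ ≡-dec _≟_ _≟_ (iter k πf one) one ⌋) (n * r) 1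

  Lmal : Fin r → Pred (Fin n) 0ℓ
  Lmal t x = ∃[ i ] (σ ⟨$⟩ʳ i ≡ x × z i ≡ t × (∀ j → j < i → σ ⟨$⟩ʳ j < σ ⟨$⟩ʳ i))

  Lmap : Fin r → Pred (Fin n) 0ℓ
  Lmap t i = z i ≡ t × (∀ j → j < i → σ ⟨$⟩ʳ j < σ ⟨$⟩ʳ i)

module _ {r n : ℕ} (b : Fin n → Fin n × Fin r) where
  private
    c : Fin n → Fin n
    c i = proj₁ (b i)
    e : Fin n → Fin r
    e i = proj₂ (b i)

  Max : Fin r → Pred (Fin n) 0ℓ
  Max t i = c i ≡ i × e i ≡ t

  Min : Fin r → Pred (Fin n) 0ℓ
  Min t i = c i ≡ first i × e i ≡ t

  Rmil : Fin r → Pred (Fin n) 0ℓ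
  Rmil t x = ∃[ i ] (c i ≡ x × e i ≡ t × (∀ j → i < j → c i < c j))

  Rmip : Fin r → Pred (Fin n) 0ℓ
  Rmip t i = e i ≡ t × (∀ j → i < j → c i < c j)

-- The B-code entry b_i = π^{-K_i}(i^[0]) is where the backward walk from i first reaches a base
-- value ≤ i; before step K_i the walk stays strictly above i.  Hence c_i = i exactly when i is the
-- minimum of its cycle (and then K_i is the cycle length), and c_i = 1 exactly when i is a
-- left-to-right minimum of the cycle of 1 read forwards.  If σ_i is a left-to-right maximum of σ
-- then σ^{-1}(σ_i) = i ≤ σ_i, so K = 1 and c_{σ_i} = i; conversely the right-to-left minima of c
-- all arise this way.  Finally π^{K_i}(b_i) = i^[0], so the colour of b_i is the negative of the
-- colour accumulated along the walk, which is r - t when that colour is t.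

module Submission where

open import Defs
open import Data.Bool using (Bool; true; false; T; if_then_else_)
open import Data.Empty using (⊥-elim)
open import Data.Fin as Fin using (Fin; toℕ)
import Data.Fin.Properties as Finₚ
open import Data.Fin.Permutation using (_⟨$⟩ʳ_; _⟨$⟩ˡ_; inverseˡ; inverseʳ)
open import Data.List using (map; upTo; [_]; _++_)
open import Data.List.Properties using (upTo-∷ʳ; map-++)
open import Data.Nat using (ℕ; zero; suc; _+_; _*_; _∸_; _≤_; _<_; z≤n; s≤s; NonZero; >-nonZero; >-nonZero⁻¹)
open import Data.Nat.DivMod
open import Data.Nat.ListAction using (sum)
open import Data.Nat.ListAction.Properties using (sum-++)
open import Data.Nat.Properties
open import Data.Product using (∃-syntax; _×_; _,_; proj₁; proj₂)
open import Data.Product.Properties using (≡-dec)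
open import Data.Sum using (inj₁; inj₂)
open import Data.Unit using (tt)
open import Function using (_∘_)
open import Function.Bundles using (_⇔_; mk⇔)
open import Relation.Binary.Definitions using (Tri; tri<; tri≈; tri>)
open import Relation.Binary.PropositionalEquality hiding ([_])
open import Relation.Nullary using (Dec; ¬_; contradiction)
open import Relation.Nullary.Decidable using (⌊_⌋; isYes≗does; dec-true; dec-false; does-⇔; toWitness)
open import Relation.Unary using (_≐_)

module _ {A : Set} where

  ⌊⌋-yes : (a? : Dec A) → A → ⌊ a? ⌋ ≡ true
  ⌊⌋-yes a? a = trans (isYes≗does a?) (dec-true a? a)

  ⌊⌋-no : (a? : Dec A) → ¬ A → ⌊ a? ⌋ ≡ false
  ⌊⌋-no a? ¬a = trans (isYes≗does a?) (dec-false a? ¬a)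

  ⌊⌋-yes⇒ : (a? : Dec A) → ⌊ a? ⌋ ≡ true → A
  ⌊⌋-yes⇒ a? eq = toWitness (subst T (sym eq) tt)

  ⌊⌋-cong : {B : Set} → A ⇔ B → (a? : Dec A) (b? : Dec B) → ⌊ a? ⌋ ≡ ⌊ b? ⌋
  ⌊⌋-cong A⇔B a? b? = trans (isYes≗does a?) (trans (does-⇔ A⇔B a? b?) (sym (isYes≗does b?)))

module _ {A : Set} where

  iter-+ : ∀ a b (f : A → A) x → iter (a + b) f x ≡ iter a f (iter b f x)
  iter-+ zero    b f x = refl
  iter-+ (suc a) b f x = cong f (iter-+ a b f x)

  iter-sucʳ : ∀ k (f : A → A) x → iter (suc k) f x ≡ iter k f (f x)
  iter-sucʳ k f x = trans (cong (λ m → iter m f x) (+-comm 1 k)) (iter-+ k 1 f x)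

  iter-*-period : ∀ a {L} (f : A → A) {y} → iter L f y ≡ y → iter (a * L) f y ≡ y
  iter-*-period zero    f per = refl
  iter-*-period (suc a) {L} f {y} per =
    trans (iter-+ L (a * L) f y) (trans (cong (iter L f) (iter-*-period a f per)) per)

  iter-%-period : ∀ m {L} .{{_ : NonZero L}} (f : A → A) {y} → iter L f y ≡ y →
                  iter m f y ≡ iter (m % L) f y
  iter-%-period m {L} f {y} per = begin
    iter m f y                            ≡⟨ cong (λ k → iter k f y) (m≡m%n+[m/n]*n m L) ⟩
    iter (m % L + m / L * L) f y          ≡⟨ iter-+ (m % L) (m / L * L) f y ⟩
    iter (m % L) f (iter (m / L * L) f y) ≡⟨ cong (iter (m % L) f) (iter-*-period (m / L) f per) ⟩
    iter (m % L) f y                      ∎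
    where open ≡-Reasoning

  module _ (f h : A → A) (h∘f : ∀ u → h (f u) ≡ u) where

    iter-leftInverse : ∀ a u → iter a h (iter a f u) ≡ u
    iter-leftInverse zero    u = refl
    iter-leftInverse (suc a) u = begin
      iter (suc a) h (f (iter a f u)) ≡⟨ iter-sucʳ a h _ ⟩
      iter a h (h (f (iter a f u)))   ≡⟨ cong (iter a h) (h∘f _) ⟩
      iter a h (iter a f u)           ≡⟨ iter-leftInverse a u ⟩
      u                               ∎
      where open ≡-Reasoning

    iter-undo : ∀ {K l x y} → iter K f x ≡ y → l ≤ K → iter l h y ≡ iter (K ∸ l) f x
    iter-undo {K} {l} {x} refl l≤K = begin
      iter l h (iter K f x)                  ≡⟨ cong (λ m → iter l h (iter m f x)) (sym (m+[n∸m]≡n l≤K)) ⟩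
      iter l h (iter (l + (K ∸ l)) f x)      ≡⟨ cong (iter l h) (iter-+ l (K ∸ l) f x) ⟩
      iter l h (iter l f (iter (K ∸ l) f x)) ≡⟨ iter-leftInverse l _ ⟩
      iter (K ∸ l) f x                       ∎
      where open ≡-Reasoning

    -- For a periodic point, h^k y = f^(kL - k) y.
    ∀-orbit-inverse : ∀ {L y} {P : A → Set} → 1 ≤ L → iter L f y ≡ y →
                      (∀ k → P (iter k f y)) → ∀ k → P (iter k h y)
    ∀-orbit-inverse {L} {y} {P} 1≤L per Pf k =
      subst P (sym (iter-undo (iter-*-period k f per) (m≤m*n k L))) (Pf (k * L ∸ k))
      where instance _ = >-nonZero 1≤L

orbit-period : ∀ {n} (f h : Fin n → Fin n) → (∀ u → h (f u) ≡ u) →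
               ∀ y → ∃[ L ] (1 ≤ L × L ≤ n × iter L f y ≡ y)
orbit-period {n} f h h∘f y with Finₚ.pigeonhole (n<1+n n) (λ a → iter (toℕ a) f y)
... | a , b , a<b , fa≡fb =
  toℕ b ∸ toℕ a , m<n⇒0<n∸m a<b , ≤-trans (m∸n≤m (toℕ b) (toℕ a)) (≤-pred (Finₚ.toℕ<n b)) ,
  trans (sym (iter-undo f h h∘f (sym fa≡fb) (<⇒≤ a<b))) (iter-leftInverse f h h∘f (toℕ a) y)

module _ (P : ℕ → Bool) where

  search-≥ : ∀ f k → k ≤ search P f k
  search-≥ zero    k = ≤-refl
  search-≥ (suc f) k with P k
  ... | true  = ≤-refl
  ... | false = <⇒≤ (search-≥ f (suc k))

  search-minimal : ∀ f k j → k ≤ j → j < search P f k → P j ≡ false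
  search-minimal zero    k j k≤j j<s = ⊥-elim (<⇒≱ j<s k≤j)
  search-minimal (suc f) k j k≤j j<s with P k in Pk
  ... | true  = ⊥-elim (<⇒≱ j<s k≤j)
  ... | false with m≤n⇒m<n∨m≡n k≤j
  ...   | inj₁ k<j  = search-minimal f (suc k) j k<j j<s
  ...   | inj₂ refl = Pk

  search-≤-hit : ∀ f k l → k ≤ l → l < k + f → P l ≡ true →
                 P (search P f k) ≡ true × search P f k ≤ l
  search-≤-hit zero    k l k≤l l<k+0 Pl = ⊥-elim (<⇒≱ l<k+0 (subst (_≤ l) (sym (+-identityʳ k)) k≤l))
  search-≤-hit (suc f) k l k≤l l<k+f Pl with P k in Pk
  ... | true  = Pk , k≤l
  ... | false = search-≤-hit f (suc k) l k<l (subst (l <_) (+-suc k f) l<k+f) Pl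
    where
      k<l : k < l
      k<l = ≤∧≢⇒< k≤l λ { refl → contradiction (trans (sym Pl) Pk) λ () }

  search-≥-misses : ∀ f k l → l ≤ k + f → (∀ j → k ≤ j → j < l → P j ≡ false) → l ≤ search P f k
  search-≥-misses zero    k l l≤k+0 _ = subst (l ≤_) (+-identityʳ k) l≤k+0
  search-≥-misses (suc f) k l l≤k+f misses with P k in Pk
  ... | true  = ≮⇒≥ λ k<l → contradiction (trans (sym Pk) (misses k ≤-refl k<l)) λ ()
  ... | false = search-≥-misses f (suc k) l (subst (l ≤_) (+-suc k f) l≤k+f)
                  λ j k<j j<l → misses j (<⇒≤ k<j) j<l

search-cong : ∀ {P Q} → (∀ j → P j ≡ Q j) → ∀ f k → search P f k ≡ search Q f k
search-cong P≗Q zero    k = refl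
search-cong {Q = Q} P≗Q (suc f) k rewrite P≗Q k = cong (if Q k then k else_) (search-cong P≗Q f (suc k))

module _ {r : ℕ} {{_ : NonZero r}} where

  %-absorbˡ : ∀ a b → (a % r + b) % r ≡ (a + b) % r
  %-absorbˡ a b = begin
    (a % r + b) % r         ≡⟨ %-distribˡ-+ (a % r) b r ⟩
    (a % r % r + b % r) % r ≡⟨ cong (λ x → (x + b % r) % r) (m%n%n≡m%n a r) ⟩
    (a % r + b % r) % r     ≡⟨ %-distribˡ-+ a b r ⟨
    (a + b) % r             ∎
    where open ≡-Reasoning

  %-absorbʳ : ∀ a b → (a + b % r) % r ≡ (a + b) % r
  %-absorbʳ a b = begin
    (a + b % r) % r ≡⟨ cong (_% r) (+-comm a (b % r)) ⟩
    (b % r + a) % r ≡⟨ %-absorbˡ b a ⟩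
    (b + a) % r     ≡⟨ cong (_% r) (+-comm b a) ⟩
    (a + b) % r     ∎
    where open ≡-Reasoning

  toℕ-mod : ∀ m → toℕ (m mod r) ≡ m % r
  toℕ-mod m = Finₚ.toℕ-fromℕ< (m%n<n m r)

  +[+∸]%≡% : ∀ a b → a ≤ r → (a + (b + (r ∸ a))) % r ≡ b % r
  +[+∸]%≡% a b a≤r = begin
    (a + (b + (r ∸ a))) % r ≡⟨ cong (_% r) (+-comm a _) ⟩
    (b + (r ∸ a) + a) % r   ≡⟨ cong (_% r) (+-assoc b (r ∸ a) a) ⟩
    (b + (r ∸ a + a)) % r   ≡⟨ cong (λ x → (b + x) % r) (m∸n+n≡m a≤r) ⟩
    (b + r) % r             ≡⟨ [m+n]%n≡m%n b r ⟩
    b % r                   ∎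
    where open ≡-Reasoning

  %≡0⇒≡negation : ∀ a e → a < r → e ≤ r → (a + e) % r ≡ 0 → a ≡ (r ∸ e) % r
  %≡0⇒≡negation a e a<r e≤r a+e≡0 = begin
    a                           ≡⟨ m<n⇒m%n≡m a<r ⟨
    a % r                       ≡⟨ +[+∸]%≡% e a e≤r ⟨
    (e + (a + (r ∸ e))) % r     ≡⟨ cong (_% r) (sym (+-assoc e a _)) ⟩
    (e + a + (r ∸ e)) % r       ≡⟨ cong (λ x → (x + (r ∸ e)) % r) (+-comm e a) ⟩
    (a + e + (r ∸ e)) % r       ≡⟨ %-absorbˡ (a + e) (r ∸ e) ⟨
    ((a + e) % r + (r ∸ e)) % r ≡⟨ cong (λ x → (x + (r ∸ e)) % r) a+e≡0 ⟩
    (r ∸ e) % r                 ∎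
    where open ≡-Reasoning

-- A record rather than the bare equation, so that t and e are inferable.
record Opposite {r} {{_ : NonZero r}} (t e : Fin r) : Set where
  constructor opposite
  field
    +%≡0 : (toℕ t + toℕ e) % r ≡ 0

module _ {r : ℕ} {{_ : NonZero r}} where

  opposite-sym : ∀ {t e : Fin r} → Opposite t e → Opposite e t
  opposite-sym {t} {e} (opposite t+e≡0) = opposite (trans (cong (_% r) (+-comm (toℕ e) (toℕ t))) t+e≡0)

  opposite-uniqueˡ : ∀ {t t′ e : Fin r} → Opposite t e → Opposite t′ e → t ≡ t′
  opposite-uniqueˡ {t} {t′} {e} (opposite t+e≡0) (opposite t′+e≡0) = Finₚ.toℕ-injective
    (trans (%≡0⇒≡negation _ _ (Finₚ.toℕ<n t) e≤r t+e≡0)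
           (sym (%≡0⇒≡negation _ _ (Finₚ.toℕ<n t′) e≤r t′+e≡0)))
    where e≤r = <⇒≤ (Finₚ.toℕ<n e)

  opposite-uniqueʳ : ∀ {t e e′ : Fin r} → Opposite t e → Opposite t e′ → e ≡ e′
  opposite-uniqueʳ opp opp′ = opposite-uniqueˡ (opposite-sym opp) (opposite-sym opp′)

  opposite-zero : ∀ {t : Fin r} → toℕ t ≡ 0 → Opposite t t
  opposite-zero {t} t≡0 = opposite (begin
    (toℕ t + toℕ t) % r ≡⟨ cong (λ a → (a + a) % r) t≡0 ⟩
    0 % r               ≡⟨ m<n⇒m%n≡m (>-nonZero⁻¹ r) ⟩
    0                   ∎)
    where open ≡-Reasoning

  opposite-∸ : ∀ {t e : Fin r} → toℕ e ≡ r ∸ toℕ t → Opposite t e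
  opposite-∸ {t} {e} e≡r∸t = opposite (begin
    (toℕ t + toℕ e) % r       ≡⟨ cong (λ a → (toℕ t + a) % r) e≡r∸t ⟩
    (toℕ t + (r ∸ toℕ t)) % r ≡⟨ cong (_% r) (m+[n∸m]≡n (<⇒≤ (Finₚ.toℕ<n t))) ⟩
    r % r                     ≡⟨ n%n≡0 r ⟩
    0                         ∎)
    where open ≡-Reasoning

first-≤ : ∀ {n} (x y : Fin n) → first x Fin.≤ y
first-≤ Fin.zero    y = z≤n
first-≤ (Fin.suc _) y = z≤n

module BCode {r n : ℕ} {{_ : NonZero r}} (g : G r n) where
  open G g

  σ⁺ σ⁻ : Fin n → Fin n
  σ⁺ = σ ⟨$⟩ʳ_
  σ⁻ = σ ⟨$⟩ˡ_

  σ⁻∘σ⁺ : ∀ u → σ⁻ (σ⁺ u) ≡ u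
  σ⁻∘σ⁺ u = inverseˡ σ

  σ⁺∘σ⁻ : ∀ u → σ⁺ (σ⁻ u) ≡ u
  σ⁺∘σ⁻ u = inverseʳ σ

  π⁺ π⁻ : Sig g → Sig g
  π⁺ = πf g
  π⁻ = πinv g

  proj₁-iter-π⁺ : ∀ m y col → proj₁ (iter m π⁺ (y , col)) ≡ iter m σ⁺ y
  proj₁-iter-π⁺ zero    y col = refl
  proj₁-iter-π⁺ (suc m) y col = cong σ⁺ (proj₁-iter-π⁺ m y col)

  proj₁-iter-π⁻ : ∀ m y col → proj₁ (iter m π⁻ (y , col)) ≡ iter m σ⁻ y
  proj₁-iter-π⁻ zero    y col = refl
  proj₁-iter-π⁻ (suc m) y col = cong σ⁻ (proj₁-iter-π⁻ m y col)

  zsum : ℕ → Fin n → ℕ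
  zsum m y = sum (map (λ k → toℕ (z (σpow g k y))) (upTo m))

  zsum-suc : ∀ m y → zsum (suc m) y ≡ zsum m y + toℕ (z (σpow g m y))
  zsum-suc m y = begin
    sum (map h (upTo (suc m)))      ≡⟨ cong (sum ∘ map h) (upTo-∷ʳ m) ⟨
    sum (map h (upTo m ++ [ m ]))   ≡⟨ cong sum (map-++ h (upTo m) [ m ]) ⟩
    sum (map h (upTo m) ++ [ h m ]) ≡⟨ sum-++ (map h (upTo m)) [ h m ] ⟩
    zsum m y + (h m + 0)            ≡⟨ cong (zsum m y +_) (+-identityʳ (h m)) ⟩
    zsum m y + h m                  ∎
    where
      open ≡-Reasoning
      h : ℕ → ℕ
      h k = toℕ (z (σpow g k y))

  toℕ-colour-iter-π⁺ : ∀ m y col → toℕ (proj₂ (iter m π⁺ (y , col))) ≡ (zsum m y + toℕ col) % r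
  toℕ-colour-iter-π⁺ zero    y col = sym (m<n⇒m%n≡m (Finₚ.toℕ<n col))
  toℕ-colour-iter-π⁺ (suc m) y col = begin
    toℕ ((toℕ (z (proj₁ s)) + toℕ (proj₂ s)) mod r) ≡⟨ toℕ-mod _ ⟩
    (toℕ (z (proj₁ s)) + toℕ (proj₂ s)) % r         ≡⟨ cong₂ (λ a b → (toℕ (z a) + b) % r)
                                                          (proj₁-iter-π⁺ m y col) (toℕ-colour-iter-π⁺ m y col) ⟩
    (zₘ + (zsum m y + toℕ col) % r) % r             ≡⟨ %-absorbʳ zₘ _ ⟩
    (zₘ + (zsum m y + toℕ col)) % r                 ≡⟨ cong (_% r) (+-assoc zₘ (zsum m y) (toℕ col)) ⟨
    (zₘ + zsum m y + toℕ col) % r                   ≡⟨ cong (λ a → (a + toℕ col) % r) (+-comm zₘ (zsum m y)) ⟩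
    (zsum m y + zₘ + toℕ col) % r                   ≡⟨ cong (λ a → (a + toℕ col) % r) (zsum-suc m y) ⟨
    (zsum (suc m) y + toℕ col) % r                  ∎
    where
      open ≡-Reasoning
      s = iter m π⁺ (y , col)
      zₘ = toℕ (z (σpow g m y))

  toℕ-c0 : toℕ (c0 g) ≡ 0
  toℕ-c0 = trans (toℕ-mod 0) (m<n⇒m%n≡m (>-nonZero⁻¹ r))

  π⁺∘π⁻ : ∀ s → π⁺ (π⁻ s) ≡ s
  π⁺∘π⁻ (j , col) = cong₂ _,_ (σ⁺∘σ⁻ j) (Finₚ.toℕ-injective (begin
    toℕ ((a + toℕ ((toℕ col + (r ∸ a)) mod r)) mod r) ≡⟨ toℕ-mod _ ⟩
    (a + toℕ ((toℕ col + (r ∸ a)) mod r)) % r         ≡⟨ cong (λ x → (a + x) % r) (toℕ-mod _) ⟩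
    (a + (toℕ col + (r ∸ a)) % r) % r                 ≡⟨ %-absorbʳ a _ ⟩
    (a + (toℕ col + (r ∸ a))) % r                     ≡⟨ +[+∸]%≡% a (toℕ col) a≤r ⟩
    toℕ col % r                                       ≡⟨ m<n⇒m%n≡m (Finₚ.toℕ<n col) ⟩
    toℕ col                                           ∎))
    where
      open ≡-Reasoning
      a = toℕ (z (σ⁻ j))
      a≤r = <⇒≤ (Finₚ.toℕ<n (z (σ⁻ j)))

  K : Fin n → ℕ
  K = kB g

  c : Fin n → Fin n
  c i = proj₁ (Bcode g i)

  e : Fin n → Fin r
  e i = proj₂ (Bcode g i)

  Returned : Fin n → ℕ → Bool
  Returned i k = ⌊ proj₁ (iter k π⁻ (i , c0 g)) Fin.≤? i ⌋

  returned : ∀ i k → iter k σ⁻ i Fin.≤ i → Returned i k ≡ true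
  returned i k le = ⌊⌋-yes (_ Fin.≤? i) (subst (Fin._≤ i) (sym (proj₁-iter-π⁻ k i (c0 g))) le)

  K≥1 : ∀ i → 1 ≤ K i
  K≥1 i = search-≥ (Returned i) n 1

  c≡σ⁻ᴷ : ∀ i → c i ≡ iter (K i) σ⁻ i
  c≡σ⁻ᴷ i = proj₁-iter-π⁻ (K i) i (c0 g)

  K-returns : ∀ i → Returned i (K i) ≡ true × K i ≤ n
  K-returns i with orbit-period σ⁻ σ⁺ σ⁺∘σ⁻ i
  ... | L , 1≤L , L≤n , per
    with search-≤-hit (Returned i) n 1 L 1≤L (s≤s L≤n) (returned i L (Finₚ.≤-reflexive per))
  ...   | returns , K≤L = returns , ≤-trans K≤L L≤n

  c≤ : ∀ i → c i Fin.≤ i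
  c≤ i = ⌊⌋-yes⇒ (c i Fin.≤? i) (proj₁ (K-returns i))

  K≤n : ∀ i → K i ≤ n
  K≤n i = proj₂ (K-returns i)

  <-before-K : ∀ i l → 1 ≤ l → l < K i → i Fin.< iter l σ⁻ i
  <-before-K i l 1≤l l<K = ≰⇒> λ le →
    contradiction (trans (sym (returned i l le)) (search-minimal (Returned i) n 1 l 1≤l l<K)) λ ()

  ≤-before-K : ∀ i l → l < K i → i Fin.≤ iter l σ⁻ i
  ≤-before-K i zero    _   = Finₚ.≤-refl
  ≤-before-K i (suc l) l<K = <⇒≤ (<-before-K i (suc l) (s≤s z≤n) l<K)

  K-unique : ∀ i k → 1 ≤ k → iter k σ⁻ i Fin.≤ i →
             (∀ l → 1 ≤ l → l < k → i Fin.< iter l σ⁻ i) → K i ≡ k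
  K-unique i k 1≤k returns stays with <-cmp (K i) k
  ... | tri< K<k _ _ = contradiction (stays (K i) (K≥1 i) K<k) (≤⇒≯ (subst (Fin._≤ i) (c≡σ⁻ᴷ i) (c≤ i)))
  ... | tri≈ _ K≡k _ = K≡k
  ... | tri> _ _ k<K = contradiction (<-before-K i k 1≤k k<K) (≤⇒≯ returns)

  K≡1 : ∀ i → σ⁻ i Fin.≤ i → K i ≡ 1
  K≡1 i le = K-unique i 1 ≤-refl le λ l 1≤l l<1 → contradiction l<1 (≤⇒≯ 1≤l)

  c≡σ⁻ : ∀ i → σ⁻ i Fin.≤ i → c i ≡ σ⁻ i
  c≡σ⁻ i le = trans (c≡σ⁻ᴷ i) (cong (λ k → iter k σ⁻ i) (K≡1 i le))

  c-σ⁺ : ∀ u → u Fin.≤ σ⁺ u → c (σ⁺ u) ≡ u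
  c-σ⁺ u le = trans (c≡σ⁻ (σ⁺ u) (subst (Fin._≤ σ⁺ u) (sym (σ⁻∘σ⁺ u)) le)) (σ⁻∘σ⁺ u)

  ≤σ⁺c : ∀ i → i Fin.≤ σ⁺ (c i)
  ≤σ⁺c i = subst (i Fin.≤_) (sym (iter-undo σ⁻ σ⁺ σ⁺∘σ⁻ (sym (c≡σ⁻ᴷ i)) (K≥1 i)))
                 (≤-before-K i (K i ∸ 1) (∸-monoʳ-< ≤-refl (K≥1 i)))

  bcode-colour : ∀ i → (zsum (K i) (c i) + toℕ (e i)) % r ≡ 0
  bcode-colour i = begin
    (zsum (K i) (c i) + toℕ (e i)) % r      ≡⟨ toℕ-colour-iter-π⁺ (K i) (c i) (e i) ⟨
    toℕ (proj₂ (iter (K i) π⁺ (Bcode g i))) ≡⟨ cong (toℕ ∘ proj₂)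
                                                 (iter-leftInverse π⁻ π⁺ π⁺∘π⁻ (K i) (i , c0 g)) ⟩
    toℕ (c0 g)                              ≡⟨ toℕ-c0 ⟩
    0                                       ∎
    where open ≡-Reasoning

  opposite-bcode : ∀ {w : Fin r} i {m} → toℕ w ≡ zsum m (c i) % r → K i ≡ m → Opposite w (e i)
  opposite-bcode {w} i w≡ refl = opposite (begin
    (toℕ w + toℕ (e i)) % r                ≡⟨ cong (λ a → (a + toℕ (e i)) % r) w≡ ⟩
    (zsum (K i) (c i) % r + toℕ (e i)) % r ≡⟨ %-absorbˡ (zsum (K i) (c i)) (toℕ (e i)) ⟩
    (zsum (K i) (c i) + toℕ (e i)) % r     ≡⟨ bcode-colour i ⟩
    0                                      ∎)
    where open ≡-Reasoning

  toℕ-colour-from-c0 : ∀ m y → toℕ (proj₂ (iter m π⁺ (y , c0 g))) ≡ zsum m y % r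
  toℕ-colour-from-c0 m y = trans (toℕ-colour-iter-π⁺ m y (c0 g))
    (trans (cong (λ a → (zsum m y + a) % r) toℕ-c0) (cong (_% r) (+-identityʳ (zsum m y))))

  opposite-descent : ∀ i → σ⁻ i Fin.≤ i → Opposite (z (σ⁻ i)) (e i)
  opposite-descent i le = opposite-bcode i (begin
    toℕ (z (σ⁻ i))           ≡⟨ m<n⇒m%n≡m (Finₚ.toℕ<n (z (σ⁻ i))) ⟨
    toℕ (z (σ⁻ i)) % r       ≡⟨ cong (_% r) (+-identityʳ _) ⟨
    (toℕ (z (σ⁻ i)) + 0) % r ≡⟨ cong (λ y → (toℕ (z y) + 0) % r) (c≡σ⁻ i le) ⟨
    zsum 1 (c i) % r         ∎) (K≡1 i le)
    where open ≡-Reasoning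

  backward-min⇒c≡ : ∀ x → (∀ m → x Fin.≤ iter m σ⁻ x) → c x ≡ x
  backward-min⇒c≡ x bm = Finₚ.≤-antisym (c≤ x) (subst (x Fin.≤_) (sym (c≡σ⁻ᴷ x)) (bm (K x)))

  backward-min⇒K≡cycLen : ∀ x → (∀ m → x Fin.≤ iter m σ⁻ x) → K x ≡ cycLen g x
  backward-min⇒K≡cycLen x bm =
    search-cong (λ m → ⌊⌋-cong (mk⇔ (returned⇒fixed m) (fixed⇒returned m)) _ _) n 1
    where
      returned⇒fixed : ∀ m → proj₁ (iter m π⁻ (x , c0 g)) Fin.≤ x → σpow g m x ≡ x
      returned⇒fixed m le = trans (cong (iter m σ⁺) (sym fixed⁻)) (iter-leftInverse σ⁻ σ⁺ σ⁺∘σ⁻ m x)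
        where
          fixed⁻ : iter m σ⁻ x ≡ x
          fixed⁻ = Finₚ.≤-antisym (subst (Fin._≤ x) (proj₁-iter-π⁻ m x (c0 g)) le) (bm m)
      fixed⇒returned : ∀ m → σpow g m x ≡ x → proj₁ (iter m π⁻ (x , c0 g)) Fin.≤ x
      fixed⇒returned m fixed = Finₚ.≤-reflexive (trans (proj₁-iter-π⁻ m x (c0 g))
        (trans (cong (iter m σ⁻) (sym fixed)) (iter-leftInverse σ⁺ σ⁻ σ⁻∘σ⁺ m x)))

  c≡⇒backward-min : ∀ x → c x ≡ x → ∀ m → x Fin.≤ iter m σ⁻ x
  c≡⇒backward-min x cx m = subst (x Fin.≤_) (sym (iter-%-period m σ⁻ (trans (sym (c≡σ⁻ᴷ x)) cx)))
                                 (≤-before-K x (m % K x) (m%n<n m (K x)))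
    where instance _ = >-nonZero (K≥1 x)

  cycSum-opposite : ∀ x → (∀ m → x Fin.≤ iter m σ⁻ x) → Opposite (cycSum g x) (e x)
  cycSum-opposite x bm = opposite-bcode x
    (trans (toℕ-mod _) (cong (λ y → zsum (cycLen g x) y % r) (sym (backward-min⇒c≡ x bm))))
    (backward-min⇒K≡cycLen x bm)

  LRMax : Fin n → Set
  LRMax i = ∀ j → j Fin.< i → σ⁺ j Fin.< σ⁺ i

  RLMin : Fin n → Set
  RLMin j = ∀ j′ → j Fin.< j′ → c j Fin.< c j′

  lrMax⇒≤σ⁺ : ∀ i → LRMax i → i Fin.≤ σ⁺ i
  lrMax⇒≤σ⁺ i lr = ≮⇒≥ λ σ⁺i<i →
    <⇒≱ (lr (c (σ⁺ i)) (≤-<-trans (c≤ (σ⁺ i)) σ⁺i<i)) (≤σ⁺c (σ⁺ i))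

  lrMax⇒rlMin : ∀ i → LRMax i → c (σ⁺ i) ≡ i → RLMin (σ⁺ i)
  lrMax⇒rlMin i lr ci j′ j<j′ = subst (Fin._< c j′) (sym ci) (compare (Finₚ.<-cmp i (c j′)))
    where
      compare : Tri (i Fin.< c j′) (i ≡ c j′) (c j′ Fin.< i) → i Fin.< c j′
      compare (tri< i<cj′ _ _) = i<cj′
      compare (tri≈ _ refl _)  = contradiction (≤σ⁺c j′) (<⇒≱ j<j′)
      compare (tri> _ _ cj′<i) = contradiction (≤σ⁺c j′) (<⇒≱ (<-trans (lr (c j′) cj′<i) j<j′))

  rlMin⇒descent : ∀ j → RLMin j → σ⁻ j Fin.≤ j
  rlMin⇒descent j rl = subst (Fin._≤ j) (sym σ⁻j≡cj) (c≤ j)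
    where
      σ⁺cj≡j : σ⁺ (c j) ≡ j
      σ⁺cj≡j with m≤n⇒m<n∨m≡n (≤σ⁺c j)
      ... | inj₂ j≡σ⁺cj = sym (Finₚ.toℕ-injective j≡σ⁺cj)
      ... | inj₁ j<σ⁺cj = contradiction (cong toℕ (sym cσ⁺cj≡cj)) (<⇒≢ (rl (σ⁺ (c j)) j<σ⁺cj))
        where
          cσ⁺cj≡cj : c (σ⁺ (c j)) ≡ c j
          cσ⁺cj≡cj = c-σ⁺ (c j) (<⇒≤ (≤-<-trans (c≤ j) j<σ⁺cj))
      σ⁻j≡cj : σ⁻ j ≡ c j
      σ⁻j≡cj = trans (cong σ⁻ (sym σ⁺cj≡j)) (σ⁻∘σ⁺ (c j))

  rlMin⇒lrMax : ∀ j → RLMin j → σ⁻ j Fin.≤ j → LRMax (σ⁻ j)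
  rlMin⇒lrMax j rl desc p p<σ⁻j = subst (σ⁺ p Fin.<_) (sym (σ⁺∘σ⁻ j)) (compare (Finₚ.<-cmp (σ⁺ p) j))
    where
      compare : Tri (σ⁺ p Fin.< j) (σ⁺ p ≡ j) (j Fin.< σ⁺ p) → σ⁺ p Fin.< j
      compare (tri< σ⁺p<j _ _) = σ⁺p<j
      compare (tri≈ _ σ⁺p≡j _) =
        contradiction (cong toℕ (trans (sym (σ⁻∘σ⁺ p)) (cong σ⁻ σ⁺p≡j))) (<⇒≢ p<σ⁻j)
      compare (tri> _ _ j<σ⁺p) = contradiction (rl (σ⁺ p) j<σ⁺p) (<⇒≯ cσ⁺p<cj)
        where
          cσ⁺p≡p : c (σ⁺ p) ≡ p
          cσ⁺p≡p = c-σ⁺ p (<⇒≤ (<-≤-trans p<σ⁻j (≤-trans desc (<⇒≤ j<σ⁺p))))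
          cσ⁺p<cj : c (σ⁺ p) Fin.< c j
          cσ⁺p<cj = subst₂ Fin._<_ (sym cσ⁺p≡p) (sym (c≡σ⁻ j desc)) p<σ⁻j

  module _ {t e₀ : Fin r} (opp : Opposite t e₀) where

    cyc≐max : Cyc g t ≐ Max (Bcode g) e₀
    cyc≐max = to , from
      where
        to : ∀ {x} → Cyc g t x → Max (Bcode g) e₀ x
        to {x} (forward-min , cycSum≡t) = backward-min⇒c≡ x backward-min ,
          opposite-uniqueʳ (subst (λ w → Opposite w (e x)) cycSum≡t (cycSum-opposite x backward-min)) opp
          where
            backward-min : ∀ m → x Fin.≤ iter m σ⁻ x
            backward-min with orbit-period σ⁺ σ⁻ σ⁻∘σ⁺ x
            ... | L , 1≤L , _ , per = ∀-orbit-inverse σ⁺ σ⁻ σ⁻∘σ⁺ {P = x Fin.≤_} 1≤L per forward-min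
        from : ∀ {x} → Max (Bcode g) e₀ x → Cyc g t x
        from {x} (cx , ex) =
          ∀-orbit-inverse σ⁻ σ⁺ σ⁺∘σ⁻ {P = x Fin.≤_} (K≥1 x) (trans (sym (c≡σ⁻ᴷ x)) cx)
            (c≡⇒backward-min x cx) ,
          opposite-uniqueˡ (subst (Opposite _) ex (cycSum-opposite x (c≡⇒backward-min x cx))) opp

    lmic⇒min : ∀ {x} → Lmic g t x → Min (Bcode g) e₀ x
    lmic⇒min {x} (k , 1≤k , _ , reach , above) = cx , ex
      where
        forward : iter k σ⁺ (first x) ≡ x
        forward = trans (sym (proj₁-iter-π⁺ k (first x) (c0 g))) (cong proj₁ reach)
        back : iter k σ⁻ x ≡ first x
        back = trans (cong (iter k σ⁻) (sym forward)) (iter-leftInverse σ⁺ σ⁻ σ⁻∘σ⁺ k (first x))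
        Kx : K x ≡ k
        Kx = K-unique x k 1≤k (subst (Fin._≤ x) (sym back) (first-≤ x x)) λ l 1≤l l<k →
          subst (x Fin.<_) (sym (trans (iter-undo σ⁺ σ⁻ σ⁻∘σ⁺ forward (<⇒≤ l<k))
                                       (sym (proj₁-iter-π⁺ (k ∸ l) (first x) (c0 g)))))
            (above (k ∸ l) (m<n⇒0<n∸m l<k) (∸-monoʳ-< 1≤l (<⇒≤ l<k)))
        cx : c x ≡ first x
        cx = trans (c≡σ⁻ᴷ x) (trans (cong (λ m → iter m σ⁻ x) Kx) back)
        ex : e x ≡ e₀
        ex = opposite-uniqueʳ (opposite-bcode x (trans (cong (toℕ ∘ proj₂) (sym reach))
               (trans (toℕ-colour-from-c0 k (first x)) (cong (λ y → zsum k y % r) (sym cx)))) Kx) opp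

    min⇒lmic : ∀ {i} → Min (Bcode g) e₀ i → Lmic g t i
    min⇒lmic {i} (ci , ei) = K i , K≥1 i , K≤return , cong₂ _,_ reach colour , above
      where
        back : iter (K i) σ⁻ i ≡ first i
        back = trans (sym (c≡σ⁻ᴷ i)) ci
        above : ∀ l → 1 ≤ l → l < K i → i Fin.< proj₁ (iter l π⁺ (first i , c0 g))
        above l 1≤l l<K = subst (i Fin.<_)
          (sym (trans (proj₁-iter-π⁺ l (first i) (c0 g)) (iter-undo σ⁻ σ⁺ σ⁺∘σ⁻ back (<⇒≤ l<K))))
          (<-before-K i (K i ∸ l) (m<n⇒0<n∸m l<K) (∸-monoʳ-< 1≤l (<⇒≤ l<K)))
        reach : proj₁ (iter (K i) π⁺ (first i , c0 g)) ≡ i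
        reach = trans (proj₁-iter-π⁺ (K i) (first i) (c0 g))
          (trans (cong (iter (K i) σ⁺) (sym back)) (iter-leftInverse σ⁻ σ⁺ σ⁺∘σ⁻ (K i) i))
        colour : proj₂ (iter (K i) π⁺ (first i , c0 g)) ≡ t
        colour = opposite-uniqueˡ (subst (Opposite _) ei (opposite-bcode i
          (trans (toℕ-colour-from-c0 (K i) (first i)) (cong (λ y → zsum (K i) y % r) (sym ci))) refl)) opp
        K≤return = search-≥-misses _ (n * r) 1 (K i) (≤-trans (K≤n i) (≤-trans (m≤m*n n r) (n≤1+n _)))
          λ l 1≤l l<K → ⌊⌋-no (≡-dec Fin._≟_ Fin._≟_ _ _) λ returns →
            <⇒≱ (above l 1≤l l<K) (subst (Fin._≤ i) (cong proj₁ (sym returns)) (first-≤ i i))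

    lmap⇒rmip-σ⁺ : ∀ {i} → Lmap g t i → c (σ⁺ i) ≡ i × Rmip (Bcode g) e₀ (σ⁺ i)
    lmap⇒rmip-σ⁺ {i} (zi≡t , lr) = ci , ei , lrMax⇒rlMin i lr ci
      where
        ci = c-σ⁺ i (lrMax⇒≤σ⁺ i lr)
        desc = subst (Fin._≤ σ⁺ i) (sym (σ⁻∘σ⁺ i)) (lrMax⇒≤σ⁺ i lr)
        ei = opposite-uniqueʳ (subst (λ w → Opposite w (e (σ⁺ i))) (trans (cong z (σ⁻∘σ⁺ i)) zi≡t)
               (opposite-descent (σ⁺ i) desc)) opp

    rmip⇒lmap-σ⁻ : ∀ {j} → Rmip (Bcode g) e₀ j → c j ≡ σ⁻ j × Lmap g t (σ⁻ j)
    rmip⇒lmap-σ⁻ {j} (ej , rl) = c≡σ⁻ j desc ,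
      opposite-uniqueˡ (subst (Opposite _) ej (opposite-descent j desc)) opp , rlMin⇒lrMax j rl desc
      where desc = rlMin⇒descent j rl

    lmic≐min : Lmic g t ≐ Min (Bcode g) e₀
    lmic≐min = lmic⇒min , min⇒lmic

    lmap≐rmil : Lmap g t ≐ Rmil (Bcode g) e₀
    lmap≐rmil = (λ {i} lmap → σ⁺ i , lmap⇒rmip-σ⁺ lmap)
              , (λ { (j , refl , rmip) → let (cj , lmap) = rmip⇒lmap-σ⁻ rmip in
                       subst (Lmap g t) (sym cj) lmap })

    lmal≐rmip : Lmal g t ≐ Rmip (Bcode g) e₀
    lmal≐rmip = (λ { (i , refl , lmap) → proj₂ (lmap⇒rmip-σ⁺ lmap) })
              , (λ {j} rmip → σ⁻ j , σ⁺∘σ⁻ j , proj₂ (rmip⇒lmap-σ⁻ rmip))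

bcode-statistics : ∀ {r n} {{_ : NonZero r}} (π : G r n) {t e : Fin r} → Opposite t e →
  (Cyc π t ≐ Max (Bcode π) e) × (Lmic π t ≐ Min (Bcode π) e)
    × (Lmap π t ≐ Rmil (Bcode π) e) × (Lmal π t ≐ Rmip (Bcode π) e)
bcode-statistics π opp = cyc≐max opp , lmic≐min opp , lmap≐rmil opp , lmal≐rmip opp
  where open BCode π

lemma3p4 : (r n : ℕ) → {{_ : NonZero r}} → (π : G r n) →
    ((t : Fin r) → toℕ t ≡ 0 →
      (Cyc π t ≐ Max (Bcode π) t) × (Lmic π t ≐ Min (Bcode π) t)
        × (Lmap π t ≐ Rmil (Bcode π) t) × (Lmal π t ≐ Rmip (Bcode π) t))
    × ((t e : Fin r) → 1 ≤ toℕ t → toℕ e ≡ r ∸ toℕ t →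
      (Cyc π t ≐ Max (Bcode π) e) × (Lmic π t ≐ Min (Bcode π) e)
        × (Lmap π t ≐ Rmil (Bcode π) e) × (Lmal π t ≐ Rmip (Bcode π) e))
lemma3p4 r n π = (λ t t≡0 → bcode-statistics π (opposite-zero t≡0))
                , (λ t e _ e≡r∸t → bcode-statistics π (opposite-∸ e≡r∸t))
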